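{- Let $n>10$ be an integer. Then $A085680(n+1)\geq a(n)$, where \[ a(n)=\begin{cases}\frac{1}{10}(n^2+n+20) & \text{if } n\equiv 0 \text{ or } 4 \pmod 5,\\[2pt] \frac{1}{10}(n^2+n+18) & \text{if } n\equiv 1 \text{ or } 3 \pmod 5,\\[2pt] \frac{1}{10}(n^2+n+14) & \text{if } n\equiv 2 \pmod 5.\end{cases} \]
   Context: For an integer $m\ge 2$, $A085680(m)$ denotes the maximum number of binary vectors of length $m$ and constant weight $2$ forming a code that can correct a single adjacent transposition; equivalently, $A085680(m)=\rho(\Gamma_m)$, where $\Gamma_m$ is the graph whose vertices are the binary vectors of length $m$ with exactly two 1's, two vertices being adjacent iff one is obtained from the other by swapping a pair of adjacent bits. ($\Gamma_m$ is isomorphic to the 2-token graph of the path $P_m$.) A packing set of a graph $G$ is a set $S\subseteq V(G)$ such that any two distinct $u,v\in S$ satisfy $d_G(u,v)\ge 3$; the packing number $\rho(G)$ is the maximum cardinality of a packing set of $G$. -}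

module Defs where

open import Data.Nat using (ℕ; zero; suc; _+_; _*_; _≤_; _/_; _%_)
open import Data.Bool using (Bool; true; false)
open import Data.Fin using (Fin; toℕ)
open import Data.Vec using (Vec; lookup; count)
open import Data.List using (List; length)
open import Data.List.Membership.Propositional using (_∈_)
open import Data.List.Relation.Unary.Unique.Propositional using (Unique)
open import Data.Product using (Σ; ∃; _×_; _,_)
open import Relation.Binary.PropositionalEquality using (_≡_; _≢_)
open import Relation.Nullary using (¬_)
open import Data.Bool using (T)

BinVec : ℕ → Set
BinVec m = Vec Bool m

weight : ∀ {m} → BinVec m → ℕ
weight v = count T? v
  where
  open import Data.Bool.Properties using (T?)

IsVertex : ∀ {m} → BinVec m → Set
IsVertex v = weight v ≡ 2

SwapAdj : ∀ {m} → BinVec m → BinVec m → Set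
SwapAdj {m} v v' =
  Σ (Fin m) λ i → Σ (Fin m) λ j →
    (toℕ j ≡ suc (toℕ i)) ×
    (lookup v' i ≡ lookup v j) ×
    (lookup v' j ≡ lookup v i) ×
    (∀ (k : Fin m) → k ≢ i → k ≢ j → lookup v' k ≡ lookup v k)

-- adjacency in Γ_m (simple graph: no loops)
Adj : ∀ {m} → BinVec m → BinVec m → Set
Adj u v = (u ≢ v) × SwapAdj u v

-- d(u,v) ≥ 3 for distinct vertices u,v: not adjacent, no common neighbour
-- (vertex of Γ_m)
FarApart : ∀ {m} → BinVec m → BinVec m → Set
FarApart {m} u v =
  ¬ Adj u v × (∀ (w : BinVec m) → IsVertex w → ¬ (Adj u w × Adj w v))

IsPackingSet : ∀ {m} → List (BinVec m) → Set
IsPackingSet {m} S =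
  Unique S ×
  (∀ {u} → u ∈ S → IsVertex u) ×
  (∀ {u v} → u ∈ S → v ∈ S → u ≢ v → FarApart u v)

a : ℕ → ℕ
a n with n % 5
... | 0 = (n * n + n + 20) / 10
... | 4 = (n * n + n + 20) / 10
... | 1 = (n * n + n + 18) / 10
... | 3 = (n * n + n + 18) / 10
... | _ = (n * n + n + 14) / 10

-- A085680(m) ≥ k  ⟺  ρ(Γ_m) ≥ k  ⟺  Γ_m has a packing set of size ≥ k
A085680-≥ : ℕ → ℕ → Set
A085680-≥ m k = Σ (List (BinVec m)) λ S → IsPackingSet S × (k ≤ length S)

module Submission where

-- A weight-2 vector of length m is a grid point (i , j) with i < j < m, the positions of
-- its ones, and swapping two adjacent distinct bits moves one of i, j by one.  So every
-- neighbour in Γ_m is a grid neighbour, and grid points that are neither one nor two grid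
-- steps apart ("separated") encode vertices at distance ≥ 3.  Two criteria give
-- separation: ℓ¹-distance at least 3, or being distinct points of one class of the perfect
-- code i + 2j ≡ c (mod 5) of the grid.
--
-- A configuration of size n is a packing corner ++ bulk ++ cap of the triangle
-- 0 ≤ i < j ≤ n: a fixed corner block (j ≤ 5), class-c bulk points in the rows i ≤ n - 6,
-- and a cap in the last five rows; it also carries a "strip" of eight class-c points.
-- Growing to size n + 5 shifts cap and strip by (5 , 5) and adds to the bulk one class-c
-- point per bulk row in the five new columns plus the old strip: n + 3 = a(n + 5) - a(n)
-- new points.  Five starting configurations (sizes 11, …, 15), certified by evaluation,
-- then cover every n > 10.

open import Defs
open import Data.Bool using (Bool; true; false; _∨_)
open import Data.Bool.Properties using (∨-zeroʳ)
open import Data.Empty using (⊥; ⊥-elim)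
open import Data.Fin using (Fin; toℕ; fromℕ<)
open import Data.Fin.Properties using (toℕ-injective; toℕ-fromℕ<; toℕ<n) renaming (_≟_ to _≟ᶠ_)
open import Data.List using (List; []; _∷_; map; length; _++_; applyUpTo)
open import Data.List.Membership.Propositional using (_∈_)
open import Data.List.Membership.Propositional.Properties using (∈-map⁻)
open import Data.List.Properties using (length-map; length-++; length-applyUpTo)
open import Data.List.Relation.Unary.All as All using (All; []; _∷_)
import Data.List.Relation.Unary.All.Properties as All
open import Data.List.Relation.Unary.AllPairs as AllPairs using (AllPairs; []; _∷_)
import Data.List.Relation.Unary.AllPairs.Properties as AllPairs
open import Data.List.Relation.Unary.Any using (here; there)
open import Data.List.Relation.Unary.Unique.Propositional using (Unique)
open import Data.Nat using (ℕ; zero; suc; _+_; _*_; _∸_; _≤_; _<_; _%_; _/_; ∣_-_∣; z≤n; s≤s; NonZero)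
open import Data.Nat.Properties using
  ( _≟_; _<?_; _≤?_; <⇒≢; <-irrefl; <-asym; <-trans; ≤-trans; ≤-<-trans; ≤-reflexive; <⇒≤; <⇒≱
  ; 1+n≢n; n<1+n; n≤1+n; ≤∧≢⇒<; ≤-pred; m≤m+n; m≤n+m; m+n≤o⇒n≤o; m+n≤o⇒m≤o∸n
  ; +-comm; +-assoc; +-mono-≤; +-monoʳ-≤; +-monoˡ-≤; +-cancelˡ-≤; +-cancelˡ-≡; m∸n+n≡m; m+[n∸m]≡n
  ; ∣n-n∣≡0; ∣-∣-comm; ∣-∣-triangle; m≤n⇒∣m-n∣≡n∸m; ∣m+n-m+o∣≡∣n-o∣; module ≤-Reasoning )
open import Data.Nat.DivMod
  using ([m+kn]%n≡m%n; %-distribˡ-+; m*n%n≡0; m≡m%n+[m/n]*n; m%n<n; m<n⇒m%n≡m; +-distrib-/-∣ʳ; m*n/n≡m)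
open import Data.Nat.Divisibility using (divides)
open import Data.Nat.Tactic.RingSolver using (solve-∀)
open import Data.Product using (Σ; _×_; _,_; proj₁; proj₂)
open import Data.Sum using (_⊎_; inj₁; inj₂)
open import Data.Vec using (lookup; tabulate)
open import Data.Vec.Properties using (tabulate∘lookup; tabulate-cong; lookup∘tabulate)
open import Function using (_∘_)
open import Relation.Nullary using (¬_; Dec; yes; no; does)
open import Relation.Nullary.Decidable using (dec-true; dec-false; True; toWitness; _×-dec_)
open import Relation.Binary.PropositionalEquality
  using (_≡_; _≢_; refl; sym; trans; cong; cong₂; subst; ≢-sym; module ≡-Reasoning)

Pt : Set
Pt = ℕ × ℕ

InRange : ℕ → Pt → Set
InRange m (i , j) = i < j × j < m

data Step : Pt → Pt → Set where
  up-i   : ∀ {i j} → Step (i , j) (suc i , j)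
  down-i : ∀ {i j} → Step (suc i , j) (i , j)
  up-j   : ∀ {i j} → Step (i , j) (i , suc j)
  down-j : ∀ {i j} → Step (i , suc j) (i , j)

step-sym : ∀ {p q} → Step p q → Step q p
step-sym up-i   = down-i
step-sym down-i = up-i
step-sym up-j   = down-j
step-sym down-j = up-j

ones : Pt → ℕ → Bool
ones (i , j) y = does (y ≟ i) ∨ does (y ≟ j)

encode : ∀ m → Pt → BinVec m
encode m p = tabulate (ones p ∘ toℕ)

ones-fst : ∀ i j → ones (i , j) i ≡ true
ones-fst i j rewrite dec-true (i ≟ i) refl = refl

ones-snd : ∀ i j → ones (i , j) j ≡ true
ones-snd i j rewrite dec-true (j ≟ j) refl = ∨-zeroʳ _

ones-out : ∀ {i j y} → y ≢ i → y ≢ j → ones (i , j) y ≡ false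
ones-out {i} {j} {y} y≢i y≢j rewrite dec-false (y ≟ i) y≢i | dec-false (y ≟ j) y≢j = refl

ones-in : ∀ {i j y} → ones (i , j) y ≡ true → y ≡ i ⊎ y ≡ j
ones-in {i} {j} {y} eq with y ≟ i | y ≟ j
... | yes y≡i | _       = inj₁ y≡i
... | no _    | yes y≡j = inj₂ y≡j
... | no y≢i  | no y≢j  with () ← trans (sym eq) (ones-out y≢i y≢j)

ones-moveˡ : ∀ {i i′ j y} → y ≢ i → y ≢ i′ → ones (i′ , j) y ≡ ones (i , j) y
ones-moveˡ {i} {i′} {j} {y} y≢i y≢i′ rewrite dec-false (y ≟ i) y≢i | dec-false (y ≟ i′) y≢i′ = refl

ones-moveʳ : ∀ {i j j′ y} → y ≢ j → y ≢ j′ → ones (i , j′) y ≡ ones (i , j) y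
ones-moveʳ {i} {j} {j′} {y} y≢j y≢j′ rewrite dec-false (y ≟ j) y≢j | dec-false (y ≟ j′) y≢j′ = refl

record Exchanges (p q : Pt) (u v : ℕ) : Set where
  field
    at-u      : ones q u ≡ ones p v
    at-v      : ones q v ≡ ones p u
    elsewhere : ∀ y → y ≢ u → y ≢ v → ones q y ≡ ones p y

exchanges-sym : ∀ {p q u v} → Exchanges p q u v → Exchanges p q v u
exchanges-sym e = record { at-u = at-v ; at-v = at-u ; elsewhere = λ y y≢v y≢u → elsewhere y y≢u y≢v }
  where open Exchanges e

move-fst : ∀ {u v j} → u ≢ v → u ≢ j → v ≢ j → Exchanges (u , j) (v , j) u v
move-fst {u} {v} {j} u≢v u≢j v≢j = record
  { at-u      = trans (ones-out u≢v u≢j) (sym (ones-out (≢-sym u≢v) v≢j))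
  ; at-v      = trans (ones-fst v j) (sym (ones-fst u j))
  ; elsewhere = λ y y≢u y≢v → ones-moveˡ y≢u y≢v }

move-snd : ∀ {i u v} → u ≢ v → u ≢ i → v ≢ i → Exchanges (i , u) (i , v) u v
move-snd {i} {u} {v} u≢v u≢i v≢i = record
  { at-u      = trans (ones-out u≢i u≢v) (sym (ones-out v≢i (≢-sym u≢v)))
  ; at-v      = trans (ones-snd i v) (sym (ones-snd i u))
  ; elsewhere = λ y y≢u y≢v → ones-moveʳ y≢u y≢v }

Neighbour : ℕ → Pt → ℕ → Set
Neighbour m p x = Σ Pt λ q → InRange m q × Step p q × Exchanges p q x (suc x)

swap-cases : ∀ {m i j} x → InRange m (i , j) → suc x < m →
             ones (i , j) x ≡ ones (i , j) (suc x) ⊎ Neighbour m (i , j) x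
swap-cases {m} {i} {j} x (i<j , j<m) sx<m with x ≟ i | x ≟ j | suc x ≟ i | suc x ≟ j
... | yes refl | _ | _ | yes refl = inj₁ (trans (ones-fst i j) (sym (ones-snd i j)))
... | yes refl | _ | _ | no sx≢j =
  inj₂ ((suc x , j) , (≤∧≢⇒< i<j sx≢j , j<m) , up-i , move-fst (≢-sym 1+n≢n) (<⇒≢ i<j) sx≢j)
... | no _ | _ | yes refl | _ =
  inj₂ ((x , j) , (<-trans (n<1+n x) i<j , j<m) , down-i ,
        exchanges-sym (move-fst 1+n≢n (<⇒≢ i<j) (<⇒≢ (<-trans (n<1+n x) i<j))))
... | no _ | yes refl | no _ | _ =
  inj₂ ((i , suc x) , (<-trans i<j (n<1+n x) , sx<m) , up-j ,
        move-snd (≢-sym 1+n≢n) (≢-sym (<⇒≢ i<j)) (≢-sym (<⇒≢ (<-trans i<j (n<1+n x)))))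
... | no x≢i | no _ | no _ | yes refl =
  inj₂ ((i , x) , (≤∧≢⇒< (≤-pred i<j) (≢-sym x≢i) , <-trans (n<1+n x) j<m) , down-j ,
        exchanges-sym (move-snd 1+n≢n (≢-sym (<⇒≢ i<j)) x≢i))
... | no x≢i | no x≢j | no sx≢i | no sx≢j =
  inj₁ (trans (ones-out x≢i x≢j) (sym (ones-out sx≢i sx≢j)))

encode-exchange : ∀ {m} p q (w : BinVec m) (a b : Fin m) → toℕ b ≡ suc (toℕ a) →
                  lookup w a ≡ lookup (encode m p) b → lookup w b ≡ lookup (encode m p) a →
                  (∀ k → k ≢ a → k ≢ b → lookup w k ≡ lookup (encode m p) k) →
                  Exchanges p q (toℕ a) (suc (toℕ a)) → w ≡ encode m q
encode-exchange {m} p q w a b b≡a+1 wa wb wk ex =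
  trans (sym (tabulate∘lookup w)) (tabulate-cong agree)
  where
  open Exchanges ex
  entry : ∀ k → lookup (encode m p) k ≡ ones p (toℕ k)
  entry = lookup∘tabulate (ones p ∘ toℕ)
  agree : ∀ k → lookup w k ≡ ones q (toℕ k)
  agree k with k ≟ᶠ a | k ≟ᶠ b
  ... | yes refl | _ = trans wa (trans (entry b) (trans (cong (ones p) b≡a+1) (sym at-u)))
  ... | no _ | yes refl = trans wb (trans (entry a) (sym (trans (cong (ones q) b≡a+1) at-v)))
  ... | no k≢a | no k≢b = trans (wk k k≢a k≢b) (trans (entry k) (sym (elsewhere (toℕ k)
        (λ e → k≢a (toℕ-injective e)) (λ e → k≢b (toℕ-injective (trans e (sym b≡a+1)))))))

neighbour-step : ∀ {m} p → InRange m p → (w : BinVec m) → Adj (encode m p) w →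
                 Σ Pt λ q → InRange m q × Step p q × w ≡ encode m q
neighbour-step {m} p p∈ w (p≢w , a , b , b≡a+1 , wa , wb , wk)
  with swap-cases (toℕ a) p∈ (subst (_< m) b≡a+1 (toℕ<n b))
... | inj₁ fixed = ⊥-elim (p≢w (sym (encode-exchange p p w a b b≡a+1 wa wb wk
        record { at-u = fixed ; at-v = sym fixed ; elsewhere = λ _ _ _ → refl })))
... | inj₂ (q , q∈ , step , ex) = q , q∈ , step , encode-exchange p q w a b b≡a+1 wa wb wk ex

weight-none : ∀ m → weight (tabulate {n = m} (λ _ → false)) ≡ 0
weight-none zero    = refl
weight-none (suc m) = weight-none m

weight-single : ∀ {m} j → j < m → weight (tabulate {n = m} (λ k → does (toℕ k ≟ j))) ≡ 1
weight-single {suc m} zero    _         = cong suc (weight-none m)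
weight-single {suc m} (suc j) (s≤s j<m) = weight-single j j<m

encode-vertex : ∀ {m} p → InRange m p → IsVertex (encode m p)
encode-vertex {suc m} (zero  , suc j) (_ , s≤s j<m)         = cong suc (weight-single j j<m)
encode-vertex {suc m} (suc i , suc j) (s≤s i<j , s≤s j<m) = encode-vertex (i , j) (i<j , j<m)

encode-ones : ∀ {m} p q → encode m p ≡ encode m q → ∀ y → y < m → ones p y ≡ ones q y
encode-ones {m} p q eq y y<m = begin
  ones p y                            ≡⟨ cong (ones p) (toℕ-fromℕ< y<m) ⟨
  ones p (toℕ k)                      ≡⟨ lookup∘tabulate (ones p ∘ toℕ) k ⟨
  lookup (encode m p) k               ≡⟨ cong (λ v → lookup v k) eq ⟩
  lookup (encode m q) k               ≡⟨ lookup∘tabulate (ones q ∘ toℕ) k ⟩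
  ones q (toℕ k)                      ≡⟨ cong (ones q) (toℕ-fromℕ< y<m) ⟩
  ones q y                            ∎
  where
  open ≡-Reasoning
  k = fromℕ< y<m

encode-injective : ∀ {m} p q → InRange m p → InRange m q → encode m p ≡ encode m q → p ≡ q
encode-injective (i , j) (i′ , j′) (i<j , j<m) (i′<j′ , j′<m) eq
  with ones-in {i′} {j′} {i} (trans (sym (encode-ones _ _ eq i (<-trans i<j j<m))) (ones-fst i j))
     | ones-in {i′} {j′} {j} (trans (sym (encode-ones _ _ eq j j<m)) (ones-snd i j))
     | ones-in {i} {j} {i′} (trans (encode-ones _ _ eq i′ (<-trans i′<j′ j′<m)) (ones-fst i′ j′))
... | inj₁ refl | inj₂ refl | _         = refl
... | inj₁ refl | inj₁ refl | _         = ⊥-elim (<-irrefl refl i<j)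
... | inj₂ refl | _         | inj₁ refl = ⊥-elim (<-irrefl refl i′<j′)
... | inj₂ refl | _         | inj₂ refl = ⊥-elim (<-asym i<j i′<j′)

Separated : Pt → Pt → Set
Separated p q = p ≢ q × ¬ Step p q × (∀ w → Step p w → Step w q → ⊥)

separated-sym : ∀ {p q} → Separated p q → Separated q p
separated-sym (p≢q , no-step , no-path) =
  ≢-sym p≢q , no-step ∘ step-sym , λ w s t → no-path w (step-sym t) (step-sym s)

separated⇒far-apart : ∀ {m} p q → InRange m p → InRange m q → Separated p q →
                      FarApart (encode m p) (encode m q)
separated⇒far-apart {m} p q p∈ q∈ (_ , no-step , no-path) = not-adjacent , no-common-neighbour
  where
  not-adjacent : ¬ Adj (encode m p) (encode m q)
  not-adjacent adj with neighbour-step p p∈ (encode m q) adj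
  ... | q′ , q′∈ , step , eq with encode-injective q q′ q∈ q′∈ eq
  ... | refl = no-step step
  no-common-neighbour : ∀ w → IsVertex w → ¬ (Adj (encode m p) w × Adj w (encode m q))
  no-common-neighbour w _ (adj₁ , adj₂) with neighbour-step p p∈ w adj₁
  ... | r , r∈ , step₁ , refl with neighbour-step r r∈ (encode m q) adj₂
  ... | q′ , q′∈ , step₂ , eq with encode-injective q q′ q∈ q′∈ eq
  ... | refl = no-path r step₁ step₂

all-pairs-∈ : ∀ {R : Pt → Pt → Set} {xs x y} → AllPairs R xs → x ∈ xs → y ∈ xs → x ≢ y → R x y ⊎ R y x
all-pairs-∈ (_ ∷ _)   (here refl) (here refl) x≢y = ⊥-elim (x≢y refl)
all-pairs-∈ (Rx ∷ _)  (here refl) (there y∈)  _   = inj₁ (All.lookup Rx y∈)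
all-pairs-∈ (Rx ∷ _)  (there x∈)  (here refl) _   = inj₂ (All.lookup Rx x∈)
all-pairs-∈ (_ ∷ Rxs) (there x∈)  (there y∈)  x≢y = all-pairs-∈ Rxs x∈ y∈ x≢y

encode-packing : ∀ {m} (S : List Pt) → AllPairs Separated S → All (InRange m) S →
                 IsPackingSet (map (encode m) S)
encode-packing {m} S sep in-range = unique S sep in-range , vertex , far
  where
  unique : ∀ xs → AllPairs Separated xs → All (InRange m) xs → Unique (map (encode m) xs)
  unique []       []         []         = []
  unique (x ∷ xs) (sx ∷ sxs) (x∈ ∷ xs∈) = distinct xs sx xs∈ ∷ unique xs sxs xs∈
    where
    distinct : ∀ ys → All (Separated x) ys → All (InRange m) ys → All (encode m x ≢_) (map (encode m) ys)
    distinct []       []         []         = []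
    distinct (y ∷ ys) (sy ∷ sys) (y∈ ∷ ys∈) =
      (λ eq → proj₁ sy (encode-injective x y x∈ y∈ eq)) ∷ distinct ys sys ys∈
  vertex : ∀ {u} → u ∈ map (encode m) S → IsVertex u
  vertex u∈ with ∈-map⁻ (encode m) u∈
  ... | p , p∈ , refl = encode-vertex p (All.lookup in-range p∈)
  far : ∀ {u v} → u ∈ map (encode m) S → v ∈ map (encode m) S → u ≢ v → FarApart u v
  far u∈ v∈ u≢v with ∈-map⁻ (encode m) u∈ | ∈-map⁻ (encode m) v∈
  ... | p , p∈ , refl | q , q∈ , refl with all-pairs-∈ sep p∈ q∈ (u≢v ∘ cong (encode m))
  ... | inj₁ s = separated⇒far-apart p q (All.lookup in-range p∈) (All.lookup in-range q∈) s
  ... | inj₂ s = separated⇒far-apart p q (All.lookup in-range p∈) (All.lookup in-range q∈) (separated-sym s)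

dist : Pt → Pt → ℕ
dist (i , j) (i′ , j′) = ∣ i - i′ ∣ + ∣ j - j′ ∣

Distant : Pt → Pt → Set
Distant p q = 3 ≤ dist p q

∣n-1+n∣≡1 : ∀ n → ∣ n - suc n ∣ ≡ 1
∣n-1+n∣≡1 zero    = refl
∣n-1+n∣≡1 (suc n) = ∣n-1+n∣≡1 n

step-dist : ∀ {p q} → Step p q → dist p q ≡ 1
step-dist {i , j}     up-i   rewrite ∣n-1+n∣≡1 i | ∣n-n∣≡0 j = refl
step-dist {suc i , j} down-i rewrite ∣-∣-comm (suc i) i | ∣n-1+n∣≡1 i | ∣n-n∣≡0 j = refl
step-dist {i , j}     up-j   rewrite ∣n-1+n∣≡1 j | ∣n-n∣≡0 i = refl
step-dist {i , suc j} down-j rewrite ∣-∣-comm (suc j) j | ∣n-1+n∣≡1 j | ∣n-n∣≡0 i = refl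

dist-triangle : ∀ p w q → dist p q ≤ dist p w + dist w q
dist-triangle (i , j) (k , l) (i′ , j′) = begin
  ∣ i - i′ ∣ + ∣ j - j′ ∣
    ≤⟨ +-mono-≤ (∣-∣-triangle i k i′) (∣-∣-triangle j l j′) ⟩
  (∣ i - k ∣ + ∣ k - i′ ∣) + (∣ j - l ∣ + ∣ l - j′ ∣)
    ≡⟨ +-interchange ∣ i - k ∣ ∣ k - i′ ∣ ∣ j - l ∣ ∣ l - j′ ∣ ⟩
  (∣ i - k ∣ + ∣ j - l ∣) + (∣ k - i′ ∣ + ∣ l - j′ ∣) ∎
  where
  open ≤-Reasoning
  +-interchange : ∀ a b c d → (a + b) + (c + d) ≡ (a + c) + (b + d)
  +-interchange = solve-∀

distant⇒separated : ∀ {p q} → Distant p q → Separated p q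
distant⇒separated {p} {q} far = p≢q , no-step , no-path
  where
  too-close : dist p q ≤ 2 → ⊥
  too-close d≤2 = <⇒≱ (s≤s d≤2) far
  p≢q : p ≢ q
  p≢q refl = too-close (≤-trans (≤-reflexive (cong₂ _+_ (∣n-n∣≡0 (proj₁ p)) (∣n-n∣≡0 (proj₂ p)))) z≤n)
  no-step : ¬ Step p q
  no-step s = too-close (≤-trans (≤-reflexive (step-dist s)) (s≤s z≤n))
  no-path : ∀ w → Step p w → Step w q → ⊥
  no-path w s t = too-close (subst (dist p q ≤_) (cong₂ _+_ (step-dist s) (step-dist t)) (dist-triangle p w q))

-- The classes of the perfect code of the grid: a step changes i + 2j by ±1 or ±2, so
-- distinct points of one class mod 5 are separated.
label : Pt → ℕ
label (i , j) = i + 2 * j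

Class : ℕ → Pt → Set
Class c p = label p % 5 ≡ c

-- Residue shift of a step, taken in {1, 2, 3, 4} so that it adds to the label mod 5.
shift : ∀ {p q} → Step p q → ℕ
shift up-i   = 1
shift down-i = 4
shift up-j   = 2
shift down-j = 3

shift-nonzero : ∀ {p q} (s : Step p q) → shift s % 5 ≢ 0
shift-nonzero up-i   ()
shift-nonzero down-i ()
shift-nonzero up-j   ()
shift-nonzero down-j ()

label-step : ∀ {p q} (s : Step p q) → label q % 5 ≡ (label p + shift s) % 5
label-step {i , j}     up-i   = cong (_% 5) (+-comm 1 (i + 2 * j))
label-step {suc i , j} down-i = trans (sym ([m+kn]%n≡m%n (i + 2 * j) 1 5)) (cong (_% 5) (down-i-label i j))
  where
  down-i-label : ∀ i j → i + 2 * j + 1 * 5 ≡ suc i + 2 * j + 4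
  down-i-label = solve-∀
label-step {i , j}     up-j   = cong (_% 5) (up-j-label i j)
  where
  up-j-label : ∀ i j → i + 2 * suc j ≡ i + 2 * j + 2
  up-j-label = solve-∀
label-step {i , suc j} down-j = trans (sym ([m+kn]%n≡m%n (i + 2 * j) 1 5)) (cong (_% 5) (down-j-label i j))
  where
  down-j-label : ∀ i j → i + 2 * j + 1 * 5 ≡ i + 2 * suc j + 3
  down-j-label = solve-∀

two-steps : ∀ {p w q} (s : Step p w) (t : Step w q) → p ≡ q ⊎ (shift s + shift t) % 5 ≢ 0
two-steps up-i   down-i = inj₁ refl
two-steps down-i up-i   = inj₁ refl
two-steps up-j   down-j = inj₁ refl
two-steps down-j up-j   = inj₁ refl
two-steps up-i   up-i   = inj₂ λ ()
two-steps up-i   up-j   = inj₂ λ ()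
two-steps up-i   down-j = inj₂ λ ()
two-steps down-i down-i = inj₂ λ ()
two-steps down-i up-j   = inj₂ λ ()
two-steps down-i down-j = inj₂ λ ()
two-steps up-j   up-i   = inj₂ λ ()
two-steps up-j   down-i = inj₂ λ ()
two-steps up-j   up-j   = inj₂ λ ()
two-steps down-j up-i   = inj₂ λ ()
two-steps down-j down-i = inj₂ λ ()
two-steps down-j down-j = inj₂ λ ()

%-cong-+ : ∀ x y d n .{{_ : NonZero n}} → x % n ≡ y % n → (x + d) % n ≡ (y + d) % n
%-cong-+ x y d n x≡y = begin
  (x + d) % n           ≡⟨ %-distribˡ-+ x d n ⟩
  (x % n + d % n) % n   ≡⟨ cong (λ r → (r + d % n) % n) x≡y ⟩
  (y % n + d % n) % n   ≡⟨ %-distribˡ-+ y d n ⟨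
  (y + d) % n           ∎
  where open ≡-Reasoning

%-shift-inv : ∀ x d n .{{_ : NonZero n}} → (x + d) % n ≡ x % n → d % n ≡ 0
%-shift-inv x d n same = begin
  d % n                 ≡⟨ [m+kn]%n≡m%n d (x / n) n ⟨
  (d + x / n * n) % n   ≡⟨ cong (_% n) quotients ⟩
  (x + d) / n * n % n   ≡⟨ m*n%n≡0 ((x + d) / n) n ⟩
  0                     ∎
  where
  open ≡-Reasoning
  rearrange : ∀ r q d → r + (d + q) ≡ d + (r + q)
  rearrange = solve-∀
  quotients : d + x / n * n ≡ (x + d) / n * n
  quotients = +-cancelˡ-≡ (x % n) _ _ (begin
    x % n + (d + x / n * n)       ≡⟨ rearrange (x % n) (x / n * n) d ⟩
    d + (x % n + x / n * n)       ≡⟨ cong (d +_) (m≡m%n+[m/n]*n x n) ⟨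
    d + x                         ≡⟨ +-comm d x ⟩
    x + d                         ≡⟨ m≡m%n+[m/n]*n (x + d) n ⟩
    (x + d) % n + (x + d) / n * n ≡⟨ cong (_+ (x + d) / n * n) same ⟩
    x % n + (x + d) / n * n       ∎)

same-class⇒separated : ∀ {c p q} → Class c p → Class c q → p ≢ q → Separated p q
same-class⇒separated {c} {p} {q} cp cq p≢q = p≢q , no-step , no-path
  where
  same : label q % 5 ≡ label p % 5
  same = trans cq (sym cp)
  no-step : ¬ Step p q
  no-step s = shift-nonzero s (%-shift-inv (label p) (shift s) 5 (trans (sym (label-step s)) same))
  no-path : ∀ w → Step p w → Step w q → ⊥
  no-path w s t with two-steps s t
  ... | inj₁ p≡q = p≢q p≡q
  ... | inj₂ nonzero = nonzero (%-shift-inv (label p) (shift s + shift t) 5 (begin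
    (label p + (shift s + shift t)) % 5 ≡⟨ cong (_% 5) (+-assoc (label p) (shift s) (shift t)) ⟨
    (label p + shift s + shift t) % 5   ≡⟨ %-cong-+ (label w) (label p + shift s) (shift t) 5 (label-step s) ⟨
    (label w + shift t) % 5             ≡⟨ label-step t ⟨
    label q % 5                         ≡⟨ same ⟩
    label p % 5                         ∎))
    where open ≡-Reasoning

class-rows : ∀ {c i j i′ j′} → Class c (i , j) → Class c (i′ , j′) → i < i′ → Separated (i , j) (i′ , j′)
class-rows cp cq i<i′ = same-class⇒separated cp cq (<⇒≢ i<i′ ∘ cong proj₁)

class-cols : ∀ {c i j i′ j′} → Class c (i , j) → Class c (i′ , j′) → j < j′ → Separated (i , j) (i′ , j′)
class-cols cp cq j<j′ = same-class⇒separated cp cq (<⇒≢ j<j′ ∘ cong proj₂)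

gap≤∣-∣ : ∀ k {i i′} → k + i ≤ i′ → k ≤ ∣ i - i′ ∣
gap≤∣-∣ k k+i≤i′ = subst (k ≤_) (sym (m≤n⇒∣m-n∣≡n∸m (m+n≤o⇒n≤o k k+i≤i′))) (m+n≤o⇒m≤o∸n k k+i≤i′)

distant-rows : ∀ {i j i′ j′} → 3 + i ≤ i′ → Distant (i , j) (i′ , j′)
distant-rows {i} {j} {i′} {j′} gap = ≤-trans (gap≤∣-∣ 3 gap) (m≤m+n _ ∣ j - j′ ∣)

distant-cols : ∀ {i j i′ j′} → 3 + j ≤ j′ → Distant (i , j) (i′ , j′)
distant-cols {i} {j} {i′} {j′} gap = ≤-trans (gap≤∣-∣ 3 gap) (m≤n+m _ ∣ i - i′ ∣)

distant-diagonal : ∀ {i j i′ j′} → 2 + i ≤ i′ → 2 + j ≤ j′ → Distant (i , j) (i′ , j′)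
distant-diagonal gapᵢ gapⱼ = ≤-trans (n≤1+n 3) (+-mono-≤ (gap≤∣-∣ 2 gapᵢ) (gap≤∣-∣ 2 gapⱼ))

shift5 : Pt → Pt
shift5 (i , j) = (5 + i , 5 + j)

distant-shift5 : ∀ {p q} → Distant p q → Distant (shift5 p) (shift5 q)
distant-shift5 {i , j} {i′ , j′} far =
  subst (3 ≤_) (sym (cong₂ _+_ (∣m+n-m+o∣≡∣n-o∣ 5 i i′) (∣m+n-m+o∣≡∣n-o∣ 5 j j′))) far

class-shift5 : ∀ {c} p → Class c p → Class c (shift5 p)
class-shift5 (i , j) cp = trans (cong (_% 5) (shifted-label i j)) (trans ([m+kn]%n≡m%n (i + 2 * j) 3 5) cp)
  where
  shifted-label : ∀ i j → 5 + i + 2 * (5 + j) ≡ i + 2 * j + 3 * 5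
  shifted-label = solve-∀

Cross : (Pt → Pt → Set) → List Pt → List Pt → Set
Cross R xs ys = All (λ x → All (R x) ys) xs

cross-by : ∀ {P Q : Pt → Set} {R : Pt → Pt → Set} {xs ys} →
           (∀ {x y} → P x → Q y → R x y) → All P xs → All Q ys → Cross R xs ys
cross-by r Pxs Qys = All.map (λ Px → All.map (r Px) Qys) Pxs

cross-map : ∀ {R S : Pt → Pt → Set} {xs ys} → (∀ {x y} → R x y → S x y) → Cross R xs ys → Cross S xs ys
cross-map f = All.map (All.map f)

cross-++ : ∀ {R : Pt → Pt → Set} {xs ys zs} → Cross R xs ys → Cross R xs zs → Cross R xs (ys ++ zs)
cross-++ []           []           = []
cross-++ (Rys ∷ Ryss) (Rzs ∷ Rzss) = All.++⁺ Rys Rzs ∷ cross-++ Ryss Rzss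

Corner : Pt → Set
Corner (i , j) = i < j × j ≤ 5

Bulk : ℕ → ℕ → Pt → Set
Bulk c n (i , j) = Class c (i , j) × 6 + i ≤ n × i < j × j ≤ n

Cap : ℕ → Pt → Set
Cap n (i , j) = n ≤ 5 + i × i < j × j ≤ n

-- Class-c points of the rows n - 5 ≤ i < n of the triangle of size n + 5; they join the
-- bulk when the triangle grows by five.
Strip : ℕ → ℕ → Pt → Set
Strip c n (i , j) = Class c (i , j) × n ≤ 5 + i × i < n × i < j × j ≤ 5 + n

NewColumn : ℕ → ℕ → Pt → Set
NewColumn c n (i , j) = Class c (i , j) × 6 + i ≤ n × n < j × j ≤ 5 + n

-- Each row i meets the five columns n < j ≤ n + 5 in exactly one point of class c,
-- namely at j = n + 1 + t with 2t ≡ c - i - 2(n + 1), i.e. t ≡ 3c + 2i + 4n + 4 (mod 5).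
column-point : ℕ → ℕ → ℕ → Pt
column-point c n i = (i , suc (n + (3 * c + 2 * i + 4 * n + 4) % 5))

column-point-class : ∀ {c} n i → c < 5 → Class c (column-point c n i)
column-point-class {c} n i c<5 = begin
  (i + 2 * suc (n + t % 5)) % 5                   ≡⟨ [m+kn]%n≡m%n (i + 2 * suc (n + t % 5)) (2 * (t / 5)) 5 ⟨
  (i + 2 * suc (n + t % 5) + 2 * (t / 5) * 5) % 5 ≡⟨ cong (_% 5) (collect i n (t % 5) (t / 5)) ⟩
  (i + 2 * suc (n + (t % 5 + t / 5 * 5))) % 5     ≡⟨ cong (λ x → (i + 2 * suc (n + x)) % 5) (m≡m%n+[m/n]*n t 5) ⟨
  (i + 2 * suc (n + t)) % 5                       ≡⟨ cong (_% 5) (expand c i n) ⟩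
  (c + (i + 2 * n + 2 + c) * 5) % 5               ≡⟨ [m+kn]%n≡m%n c (i + 2 * n + 2 + c) 5 ⟩
  c % 5                                           ≡⟨ m<n⇒m%n≡m c<5 ⟩
  c                                               ∎
  where
  open ≡-Reasoning
  t : ℕ
  t = 3 * c + 2 * i + 4 * n + 4
  collect : ∀ i n r q → i + 2 * suc (n + r) + 2 * q * 5 ≡ i + 2 * suc (n + (r + q * 5))
  collect = solve-∀
  expand : ∀ c i n → i + 2 * suc (n + (3 * c + 2 * i + 4 * n + 4)) ≡ c + (i + 2 * n + 2 + c) * 5
  expand = solve-∀

new-columns : ℕ → ℕ → List Pt
new-columns c n = applyUpTo (column-point c n) (n ∸ 5)

new-columns-in : ∀ c n → c < 5 → 5 ≤ n → All (NewColumn c n) (new-columns c n)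
new-columns-in c n c<5 5≤n = All.applyUpTo⁺₁ (column-point c n) (n ∸ 5) in-region
  where
  in-region : ∀ {i} → i < n ∸ 5 → NewColumn c n (column-point c n i)
  in-region {i} i<n∸5 =
    column-point-class n i c<5 ,
    subst (6 + i ≤_) (m+[n∸m]≡n 5≤n) (+-monoʳ-≤ 5 i<n∸5) ,
    s≤s (m≤m+n n _) ,
    subst (_≤ 5 + n) (cong suc (+-comm _ n)) (s≤s (+-monoˡ-≤ n (≤-pred (m%n<n (3 * c + 2 * i + 4 * n + 4) 5))))

new-columns-sep : ∀ c n → c < 5 → AllPairs Separated (new-columns c n)
new-columns-sep c n c<5 = AllPairs.applyUpTo⁺₁ (column-point c n) (n ∸ 5) separate
  where
  separate : ∀ {i i′} → i < i′ → i′ < n ∸ 5 → Separated (column-point c n i) (column-point c n i′)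
  separate {i} {i′} i<i′ _ = class-rows (column-point-class n i c<5) (column-point-class n i′ c<5) i<i′

bulk-below : ∀ {n i i′} → 6 + i ≤ n → n ≤ 5 + i′ → i < i′
bulk-below {n} {i} {i′} low high = +-cancelˡ-≤ 5 (suc i) i′ (≤-trans low high)

bulk-far-below : ∀ {n i i′} → 6 + i ≤ n → 5 + n ≤ 5 + i′ → 3 + i ≤ i′
bulk-far-below {n} {i} {i′} low high = ≤-trans (m≤n+m (3 + i) 3) (≤-trans low (+-cancelˡ-≤ 5 n i′ high))

top-rows : ∀ {n i} → 11 ≤ n → n ≤ 5 + i → 6 ≤ i
top-rows {n} {i} 11≤n high = +-cancelˡ-≤ 5 6 i (≤-trans 11≤n high)

corner-far-rows : ∀ {i j i′ j′} → Corner (i , j) → 6 ≤ i′ → i′ < j′ → Distant (i , j) (i′ , j′)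
corner-far-rows {i} {j} {i′} {j′} (i<j , j≤5) 6≤i′ i′<j′ =
  distant-diagonal {i} {j} {i′} {j′} (≤-trans (+-monoʳ-≤ 2 (≤-pred (≤-trans i<j j≤5))) 6≤i′)
                   (≤-trans (+-monoʳ-≤ 2 j≤5) (≤-trans (s≤s 6≤i′) i′<j′))

corner-far-cols : ∀ {i j i′ j′} → Corner (i , j) → 8 ≤ j′ → Distant (i , j) (i′ , j′)
corner-far-cols {i} {j} {i′} {j′} (_ , j≤5) 8≤j′ =
  distant-cols {i} {j} {i′} {j′} (≤-trans (+-monoʳ-≤ 3 j≤5) 8≤j′)

-- a grows by exactly n + 3 from n to n + 5: the additive constant depends on n mod 5 only.
a-offset : ℕ → ℕ
a-offset 0 = 20
a-offset 4 = 20
a-offset 1 = 18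
a-offset 3 = 18
a-offset _ = 14

a-closed : ∀ n → a n ≡ (n * n + n + a-offset (n % 5)) / 10
a-closed n with n % 5
... | 0 = refl
... | 1 = refl
... | 2 = refl
... | 3 = refl
... | 4 = refl
... | suc (suc (suc (suc (suc _)))) = refl

a-step : ∀ n → a (5 + n) ≡ a n + (n + 3)
a-step n = begin
  a (5 + n)                                   ≡⟨ a-closed (5 + n) ⟩
  ((5 + n) * (5 + n) + (5 + n) + k) / 10      ≡⟨ cong (_/ 10) (expand n k) ⟩
  (n * n + n + k + (n + 3) * 10) / 10         ≡⟨ +-distrib-/-∣ʳ (n * n + n + k) (divides (n + 3) refl) ⟩
  (n * n + n + k) / 10 + (n + 3) * 10 / 10    ≡⟨ cong₂ _+_ (sym (a-closed n)) (m*n/n≡m (n + 3) 10) ⟩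
  a n + (n + 3)                               ∎
  where
  open ≡-Reasoning
  k : ℕ
  k = a-offset (n % 5)
  expand : ∀ n k → (5 + n) * (5 + n) + (5 + n) + k ≡ n * n + n + k + (n + 3) * 10
  expand = solve-∀

record Config (c n : ℕ) : Set where
  field
    c<5         : c < 5
    11≤n        : 11 ≤ n
    corner      : List Pt
    bulk        : List Pt
    cap         : List Pt
    strip       : List Pt
    corner-in   : All Corner corner
    bulk-in     : All (Bulk c n) bulk
    cap-in      : All (Cap n) cap
    strip-in    : All (Strip c n) strip
    corner-sep  : AllPairs Distant corner
    bulk-sep    : AllPairs Separated bulk
    cap-sep     : AllPairs Distant cap
    strip-sep   : AllPairs Distant strip
    corner-bulk : Cross Separated corner bulk
    bulk-cap    : Cross Distant bulk cap
    strip-cap   : Cross Distant strip (map shift5 cap)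
    strip-size  : length strip ≡ 8
    size        : a n ≤ length corner + (length bulk + length cap)

corner-in-range : ∀ {n p} → 11 ≤ n → Corner p → InRange (suc n) p
corner-in-range {n} {i , j} 11≤n (i<j , j≤5) = i<j , s≤s (≤-trans j≤5 (≤-trans (m≤n+m 5 6) 11≤n))

bulk-in-range : ∀ {c n p} → Bulk c n p → InRange (suc n) p
bulk-in-range {p = i , j} (_ , _ , i<j , j≤n) = i<j , s≤s j≤n

cap-in-range : ∀ {n p} → Cap n p → InRange (suc n) p
cap-in-range {p = i , j} (_ , i<j , j≤n) = i<j , s≤s j≤n

corner-cap : ∀ {n x y} → 11 ≤ n → Corner x → Cap n y → Distant x y
corner-cap {x = i , j} {i′ , j′} 11≤n x∈ (high , i′<j′ , _) = corner-far-rows x∈ (top-rows 11≤n high) i′<j′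

corner-strip : ∀ {c n x y} → 11 ≤ n → Corner x → Strip c n y → Distant x y
corner-strip {x = i , j} {i′ , j′} 11≤n x∈ (_ , high , _ , i′<j′ , _) =
  corner-far-rows x∈ (top-rows 11≤n high) i′<j′

corner-column : ∀ {c n x y} → 11 ≤ n → Corner x → NewColumn c n y → Distant x y
corner-column {n = n} {i , j} {i′ , j′} 11≤n x∈ (_ , _ , n<j′ , _) =
  corner-far-cols {i} {j} {i′} {j′} x∈ (≤-trans (≤-trans (m≤n+m 8 3) 11≤n) (<⇒≤ n<j′))

bulk-column : ∀ {c n x y} → Bulk c n x → NewColumn c n y → Separated x y
bulk-column {x = i , j} {i′ , j′} (cx , _ , _ , j≤n) (cy , _ , n<j′ , _) = class-cols cx cy (≤-<-trans j≤n n<j′)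

bulk-strip : ∀ {c n x y} → Bulk c n x → Strip c n y → Separated x y
bulk-strip {x = i , j} {i′ , j′} (cx , low , _) (cy , high , _) = class-rows cx cy (bulk-below low high)

column-strip : ∀ {c n x y} → NewColumn c n x → Strip c n y → Separated x y
column-strip {x = i , j} {i′ , j′} (cx , low , _) (cy , high , _) = class-rows cx cy (bulk-below low high)

bulk-shifted-cap : ∀ {c n x y} → Bulk c n x → Cap (5 + n) y → Distant x y
bulk-shifted-cap {x = i , j} {i′ , j′} (_ , low , _) (high , _) =
  distant-rows {i} {j} {i′} {j′} (bulk-far-below low high)

column-shifted-cap : ∀ {c n x y} → NewColumn c n x → Cap (5 + n) y → Distant x y
column-shifted-cap {x = i , j} {i′ , j′} (_ , low , _) (high , _) =
  distant-rows {i} {j} {i′} {j′} (bulk-far-below low high)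

bulk-widen : ∀ {c n p} → Bulk c n p → Bulk c (5 + n) p
bulk-widen {n = n} {i , j} (cp , low , i<j , j≤n) = cp , ≤-trans low (m≤n+m n 5) , i<j , ≤-trans j≤n (m≤n+m n 5)

column-widen : ∀ {c n p} → NewColumn c n p → Bulk c (5 + n) p
column-widen {n = n} {i , j} (cp , low , n<j , j≤5+n) =
  cp , ≤-trans low (m≤n+m n 5) , <-trans (m+n≤o⇒n≤o 5 low) n<j , j≤5+n

strip-widen : ∀ {c n p} → Strip c n p → Bulk c (5 + n) p
strip-widen {n = n} {i , j} (cp , _ , i<n , i<j , j≤5+n) = cp , +-monoʳ-≤ 5 i<n , i<j , j≤5+n

cap-shift5 : ∀ {n p} → Cap n p → Cap (5 + n) (shift5 p)
cap-shift5 (high , i<j , j≤n) = +-monoʳ-≤ 5 high , +-monoʳ-≤ 5 i<j , +-monoʳ-≤ 5 j≤n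

strip-shift5 : ∀ {c n p} → Strip c n p → Strip c (5 + n) (shift5 p)
strip-shift5 {p = p} (cp , high , i<n , i<j , j≤5+n) =
  class-shift5 p cp , +-monoʳ-≤ 5 high , +-monoʳ-≤ 5 i<n , +-monoʳ-≤ 5 i<j , +-monoʳ-≤ 5 j≤5+n

config-bound : ∀ {c n} → Config c n → A085680-≥ (suc n) (a n)
config-bound {c} {n} cfg = map (encode (suc n)) S , encode-packing S separated in-range , enough
  where
  open Config cfg
  S : List Pt
  S = corner ++ (bulk ++ cap)
  separated : AllPairs Separated S
  separated =
    AllPairs.++⁺ (AllPairs.map distant⇒separated corner-sep)
      (AllPairs.++⁺ bulk-sep (AllPairs.map distant⇒separated cap-sep) (cross-map distant⇒separated bulk-cap))
      (cross-++ corner-bulk (cross-by (λ x∈ y∈ → distant⇒separated (corner-cap 11≤n x∈ y∈)) corner-in cap-in))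
  in-range : All (InRange (suc n)) S
  in-range = All.++⁺ (All.map (corner-in-range 11≤n) corner-in)
               (All.++⁺ (All.map bulk-in-range bulk-in) (All.map cap-in-range cap-in))
  enough : a n ≤ length (map (encode (suc n)) S)
  enough = subst (a n ≤_) (sym (begin
    length (map (encode (suc n)) S)            ≡⟨ length-map (encode (suc n)) S ⟩
    length S                                   ≡⟨ length-++ corner ⟩
    length corner + length (bulk ++ cap)       ≡⟨ cong (length corner +_) (length-++ bulk) ⟩
    length corner + (length bulk + length cap) ∎)) size
    where open ≡-Reasoning

added-size : ∀ c n {strip : List Pt} → 5 ≤ n → length strip ≡ 8 → length (new-columns c n ++ strip) ≡ n + 3
added-size c n {strip} 5≤n strip-size = begin
  length (new-columns c n ++ strip)       ≡⟨ length-++ (new-columns c n) ⟩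
  length (new-columns c n) + length strip ≡⟨ cong₂ _+_ (length-applyUpTo (column-point c n) (n ∸ 5)) strip-size ⟩
  n ∸ 5 + (5 + 3)                         ≡⟨ +-assoc (n ∸ 5) 5 3 ⟨
  n ∸ 5 + 5 + 3                           ≡⟨ cong (_+ 3) (m∸n+n≡m 5≤n) ⟩
  n + 3                                   ∎
  where open ≡-Reasoning

size-step : ∀ n {x y z} → a n ≤ x + (y + z) → a (5 + n) ≤ x + ((y + (n + 3)) + z)
size-step n {x} {y} {z} enough = begin
  a (5 + n)               ≡⟨ a-step n ⟩
  a n + (n + 3)           ≤⟨ +-monoˡ-≤ (n + 3) enough ⟩
  x + (y + z) + (n + 3)   ≡⟨ rearrange x y z (n + 3) ⟩
  x + (y + (n + 3) + z)   ∎
  where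
  open ≤-Reasoning
  rearrange : ∀ x y z w → x + (y + z) + w ≡ x + (y + w + z)
  rearrange = solve-∀

extend : ∀ {c n} → Config c n → Config c (5 + n)
extend {c} {n} cfg = record
  { c<5         = c<5
  ; 11≤n        = ≤-trans 11≤n (m≤n+m n 5)
  ; corner      = corner
  ; bulk        = bulk ++ added
  ; cap         = map shift5 cap
  ; strip       = map shift5 strip
  ; corner-in   = corner-in
  ; bulk-in     = All.++⁺ (All.map bulk-widen bulk-in)
                    (All.++⁺ (All.map column-widen columns-in) (All.map strip-widen strip-in))
  ; cap-in      = shifted-cap-in
  ; strip-in    = All.map⁺ (All.map strip-shift5 strip-in)
  ; corner-sep  = corner-sep
  ; bulk-sep    = AllPairs.++⁺ bulk-sep
                    (AllPairs.++⁺ (new-columns-sep c n c<5) (AllPairs.map distant⇒separated strip-sep)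
                      (cross-by column-strip columns-in strip-in))
                    (cross-++ (cross-by bulk-column bulk-in columns-in) (cross-by bulk-strip bulk-in strip-in))
  ; cap-sep     = AllPairs.map⁺ (AllPairs.map (λ {x} {y} → distant-shift5 {x} {y}) cap-sep)
  ; strip-sep   = AllPairs.map⁺ (AllPairs.map (λ {x} {y} → distant-shift5 {x} {y}) strip-sep)
  ; corner-bulk = cross-++ corner-bulk (cross-map distant⇒separated
                    (cross-++ (cross-by (corner-column 11≤n) corner-in columns-in)
                              (cross-by (corner-strip 11≤n) corner-in strip-in)))
  ; bulk-cap    = All.++⁺ (cross-by bulk-shifted-cap bulk-in shifted-cap-in)
                    (All.++⁺ (cross-by column-shifted-cap columns-in shifted-cap-in) strip-cap)
  ; strip-cap   = All.map⁺ (All.map (λ {x} → All.map⁺ ∘ All.map (λ {y} → distant-shift5 {x} {y})) strip-cap)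
  ; strip-size  = trans (length-map shift5 strip) strip-size
  ; size        = grown-size
  }
  where
  open Config cfg
  5≤n : 5 ≤ n
  5≤n = ≤-trans (m≤n+m 5 6) 11≤n
  added : List Pt
  added = new-columns c n ++ strip
  columns-in : All (NewColumn c n) (new-columns c n)
  columns-in = new-columns-in c n c<5 5≤n
  shifted-cap-in : All (Cap (5 + n)) (map shift5 cap)
  shifted-cap-in = All.map⁺ (All.map cap-shift5 cap-in)
  grown-size : a (5 + n) ≤ length corner + (length (bulk ++ added) + length (map shift5 cap))
  grown-size = subst (a (5 + n) ≤_)
    (cong₂ (λ k l → length corner + (k + l))
           (trans (cong (length bulk +_) (sym (added-size c n 5≤n strip-size))) (sym (length-++ bulk)))
           (sym (length-map shift5 cap)))
    (size-step n {length corner} {length bulk} {length cap} size)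

-- The properties of a configuration in decidable form, with Distant in place of
-- Separated; the starting configurations are verified by evaluating this decision.
Checked : (c n : ℕ) (corner bulk cap strip : List Pt) → Set
Checked c n corner bulk cap strip =
  c < 5 × 11 ≤ n ×
  All Corner corner × All (Bulk c n) bulk × All (Cap n) cap × All (Strip c n) strip ×
  AllPairs Distant corner × AllPairs Distant bulk × AllPairs Distant cap × AllPairs Distant strip ×
  Cross Distant corner bulk × Cross Distant bulk cap × Cross Distant strip (map shift5 cap) ×
  length strip ≡ 8 × a n ≤ length corner + (length bulk + length cap)

checked? : ∀ c n corner bulk cap strip → Dec (Checked c n corner bulk cap strip)
checked? c n corner bulk cap strip =
  c <? 5 ×-dec 11 ≤? n ×-dec
  All.all? corner? corner ×-dec All.all? bulk? bulk ×-dec All.all? cap? cap ×-dec All.all? strip? strip ×-dec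
  AllPairs.allPairs? distant? corner ×-dec AllPairs.allPairs? distant? bulk ×-dec
  AllPairs.allPairs? distant? cap ×-dec AllPairs.allPairs? distant? strip ×-dec
  cross? corner bulk ×-dec cross? bulk cap ×-dec cross? strip (map shift5 cap) ×-dec
  length strip ≟ 8 ×-dec a n ≤? length corner + (length bulk + length cap)
  where
  class? : ∀ p → Dec (Class c p)
  class? p = label p % 5 ≟ c
  corner? : ∀ p → Dec (Corner p)
  corner? (i , j) = i <? j ×-dec j ≤? 5
  bulk? : ∀ p → Dec (Bulk c n p)
  bulk? (i , j) = class? (i , j) ×-dec 6 + i ≤? n ×-dec i <? j ×-dec j ≤? n
  cap? : ∀ p → Dec (Cap n p)
  cap? (i , j) = n ≤? 5 + i ×-dec i <? j ×-dec j ≤? n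
  strip? : ∀ p → Dec (Strip c n p)
  strip? (i , j) = class? (i , j) ×-dec n ≤? 5 + i ×-dec i <? n ×-dec i <? j ×-dec j ≤? 5 + n
  distant? : ∀ p q → Dec (Distant p q)
  distant? p q = 3 ≤? dist p q
  cross? : ∀ xs ys → Dec (Cross Distant xs ys)
  cross? xs ys = All.all? (λ x → All.all? (distant? x) ys) xs

checked-config : ∀ {c n corner bulk cap strip} → Checked c n corner bulk cap strip → Config c n
checked-config {corner = corner} {bulk} {cap} {strip}
  (c<5 , 11≤n , corner-in , bulk-in , cap-in , strip-in , corner-sep , bulk-sep , cap-sep , strip-sep ,
   corner-bulk , bulk-cap , strip-cap , strip-size , size) = record
  { c<5 = c<5 ; 11≤n = 11≤n
  ; corner = corner ; bulk = bulk ; cap = cap ; strip = strip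
  ; corner-in = corner-in ; bulk-in = bulk-in ; cap-in = cap-in ; strip-in = strip-in
  ; corner-sep = corner-sep ; bulk-sep = AllPairs.map distant⇒separated bulk-sep
  ; cap-sep = cap-sep ; strip-sep = strip-sep
  ; corner-bulk = cross-map distant⇒separated corner-bulk ; bulk-cap = bulk-cap ; strip-cap = strip-cap
  ; strip-size = strip-size ; size = size
  }

seed : ∀ c n corner bulk cap strip → {True (checked? c n corner bulk cap strip)} → Config c n
seed c n corner bulk cap strip {ok} = checked-config (toWitness ok)

start : ∀ r → r < 5 → Σ ℕ λ c → Config c (11 + r)
start 0 _ = 3 , seed 3 11
  ((0 , 1) ∷ (0 , 4) ∷ (2 , 3) ∷ (3 , 5) ∷ [])
  ((0 , 9) ∷ (1 , 6) ∷ (1 , 11) ∷ (2 , 8) ∷ (3 , 10) ∷ (4 , 7) ∷ (5 , 9) ∷ [])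
  ((6 , 11) ∷ (7 , 8) ∷ (8 , 10) ∷ (10 , 11) ∷ [])
  ((6 , 11) ∷ (6 , 16) ∷ (7 , 8) ∷ (7 , 13) ∷ (8 , 10) ∷ (8 , 15) ∷ (9 , 12) ∷ (10 , 14) ∷ [])
start 1 _ = 1 , seed 1 12
  ((0 , 1) ∷ (0 , 5) ∷ (1 , 3) ∷ (3 , 4) ∷ [])
  ((0 , 8) ∷ (1 , 10) ∷ (2 , 7) ∷ (2 , 12) ∷ (3 , 9) ∷ (4 , 6) ∷ (4 , 11) ∷ (5 , 8) ∷ (6 , 10) ∷ [])
  ((7 , 12) ∷ (8 , 9) ∷ (9 , 11) ∷ (11 , 12) ∷ [])
  ((7 , 12) ∷ (7 , 17) ∷ (8 , 9) ∷ (8 , 14) ∷ (9 , 11) ∷ (9 , 16) ∷ (10 , 13) ∷ (11 , 15) ∷ [])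
start 2 _ = 1 , seed 1 13
  ((0 , 1) ∷ (0 , 5) ∷ (1 , 3) ∷ (3 , 4) ∷ [])
  ((0 , 8) ∷ (0 , 13) ∷ (1 , 10) ∷ (2 , 7) ∷ (2 , 12) ∷ (3 , 9) ∷ (4 , 6) ∷ (4 , 11) ∷ (5 , 8) ∷
   (5 , 13) ∷ (6 , 10) ∷ (7 , 12) ∷ [])
  ((8 , 9) ∷ (9 , 13) ∷ (10 , 11) ∷ (12 , 13) ∷ [])
  ((8 , 9) ∷ (8 , 14) ∷ (9 , 11) ∷ (9 , 16) ∷ (10 , 13) ∷ (10 , 18) ∷ (11 , 15) ∷ (12 , 17) ∷ [])
start 3 _ = 3 , seed 3 14
  ((0 , 1) ∷ (0 , 4) ∷ (2 , 3) ∷ (3 , 5) ∷ [])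
  ((0 , 9) ∷ (0 , 14) ∷ (1 , 6) ∷ (1 , 11) ∷ (2 , 8) ∷ (2 , 13) ∷ (3 , 10) ∷ (4 , 7) ∷ (4 , 12) ∷
   (5 , 9) ∷ (5 , 14) ∷ (6 , 11) ∷ (7 , 8) ∷ (7 , 13) ∷ (8 , 10) ∷ [])
  ((9 , 14) ∷ (10 , 11) ∷ (11 , 13) ∷ (13 , 14) ∷ [])
  ((9 , 12) ∷ (9 , 17) ∷ (10 , 14) ∷ (10 , 19) ∷ (11 , 16) ∷ (12 , 13) ∷ (12 , 18) ∷ (13 , 15) ∷ [])
start 4 _ = 1 , seed 1 15
  ((0 , 1) ∷ (0 , 5) ∷ (1 , 3) ∷ (3 , 4) ∷ [])
  ((0 , 8) ∷ (0 , 13) ∷ (1 , 10) ∷ (1 , 15) ∷ (2 , 7) ∷ (2 , 12) ∷ (3 , 9) ∷ (3 , 14) ∷ (4 , 6) ∷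
   (4 , 11) ∷ (5 , 8) ∷ (5 , 13) ∷ (6 , 10) ∷ (6 , 15) ∷ (7 , 12) ∷ (8 , 9) ∷ (8 , 14) ∷ (9 , 11) ∷ [])
  ((10 , 15) ∷ (11 , 12) ∷ (12 , 14) ∷ (14 , 15) ∷ [])
  ((10 , 13) ∷ (10 , 18) ∷ (11 , 15) ∷ (11 , 20) ∷ (12 , 17) ∷ (13 , 14) ∷ (13 , 19) ∷ (14 , 16) ∷ [])
start (suc (suc (suc (suc (suc _))))) (s≤s (s≤s (s≤s (s≤s (s≤s ())))))

configuration : ∀ q r → r < 5 → Σ ℕ λ c → Config c (q * 5 + (11 + r))
configuration zero    r r<5 = start r r<5
configuration (suc q) r r<5 with configuration q r r<5
... | c , cfg = c , extend cfg

lemma1p4 : (n : ℕ) → 10 < n → A085680-≥ (suc n) (a n)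
lemma1p4 n 10<n = subst (λ k → A085680-≥ (suc k) (a k)) size≡n (config-bound (proj₂ found))
  where
  m : ℕ
  m = n ∸ 11
  found : Σ ℕ λ c → Config c (m / 5 * 5 + (11 + m % 5))
  found = configuration (m / 5) (m % 5) (m%n<n m 5)
  regroup : ∀ x y → x + (11 + y) ≡ 11 + (y + x)
  regroup = solve-∀
  size≡n : m / 5 * 5 + (11 + m % 5) ≡ n
  size≡n = begin
    m / 5 * 5 + (11 + m % 5)   ≡⟨ regroup (m / 5 * 5) (m % 5) ⟩
    11 + (m % 5 + m / 5 * 5)   ≡⟨ cong (11 +_) (m≡m%n+[m/n]*n m 5) ⟨
    11 + m                     ≡⟨ m+[n∸m]≡n 10<n ⟩
    n                          ∎
    where open ≡-Reasoning
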